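{- Let $\mathbf L,\mathbf M$ be algebraic lattices and let $f\colon\mathbf L\to\mathbf M$, $g\colon\mathbf M\to\mathbf L$ be an adjunction ($f$ left adjoint to $g$) such that $f$ maps compact elements to compact elements. Then the restriction $f|_{\mathrm K\mathbf L}\colon\mathrm K\mathbf L\to\mathrm K\mathbf M$ has a right adjoint if, and only if, $g$ maps compact elements of $\mathbf M$ to compact elements of $\mathbf L$; and in this case the right adjoint of $f|_{\mathrm K\mathbf L}$ is $g|_{\mathrm K\mathbf M}$.
   Context: An element $k$ of a complete lattice is compact if whenever $k\le\bigvee S$ there is a finite $F\subseteq S$ with $k\le\bigvee F$; $\mathrm K\mathbf L$ denotes the set of compact elements of $\mathbf L$ (a join-subsemilattice). A complete lattice is algebraic if every element is a join of compact elements. A pair of monotone maps $f\colon P\to Q$, $g\colon Q\to P$ between posets is an adjunction ($f$ left adjoint to $g$, $g$ right adjoint to $f$) if $f(a)\le b\iff a\le g(b)$ for all $a\in P$, $b\in Q$. -}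

module Defs where

open import Level using (Level; suc)
open import Data.Product using (Σ; Σ-syntax; ∃; ∃-syntax; _×_; _,_; proj₁; proj₂)
open import Data.List using (List; []; _∷_)
open import Data.List.Relation.Unary.All using (All)
open import Data.List.Relation.Unary.Any using (Any)
open import Relation.Binary.Bundles using (Poset)
open import Relation.Unary using (Pred; _⊆_)

record CompleteLattice (a : Level) : Set (suc a) where
  field
    poset : Poset a a a
  open Poset poset public
  field
    ⋁         : Pred Carrier a → Carrier
    ⋁-upper   : (S : Pred Carrier a) → ∀ {x} → S x → x ≤ ⋁ S
    ⋁-least   : (S : Pred Carrier a) → ∀ {u} → (∀ {x} → S x → x ≤ u) → ⋁ S ≤ u

  ⟦_⟧ : List Carrier → Pred Carrier a
  ⟦ F ⟧ x = Any (x ≈_) F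

  IsCompact : Carrier → Set (suc a)
  IsCompact k = (S : Pred Carrier a) → k ≤ ⋁ S →
                Σ[ F ∈ List Carrier ] (All S F × k ≤ ⋁ ⟦ F ⟧)

  K : Set (suc a)
  K = Σ Carrier IsCompact

  _≤K_ : K → K → Set a
  x ≤K y = proj₁ x ≤ proj₁ y

  IsAlgebraic : Set (suc a)
  IsAlgebraic = (x : Carrier) →
    Σ[ S ∈ Pred Carrier a ] ((∀ {c} → S c → IsCompact c) × x ≈ ⋁ S)

open CompleteLattice

module _ {a b : Level} {A : Set a} {B : Set b} where
  Monotone : ∀ {ℓ₁ ℓ₂} → (A → A → Set ℓ₁) → (B → B → Set ℓ₂) → (A → B) → Set _
  Monotone _≤₁_ _≤₂_ f = ∀ {x y} → x ≤₁ y → f x ≤₂ f y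

IsAdjunction : ∀ {a b ℓ₁ ℓ₂} {A : Set a} {B : Set b} →
  (A → A → Set ℓ₁) → (B → B → Set ℓ₂) → (A → B) → (B → A) → Set _
IsAdjunction {A = A} {B} _≤₁_ _≤₂_ f g =
  Monotone _≤₁_ _≤₂_ f × Monotone _≤₂_ _≤₁_ g ×
  (∀ (x : A) (y : B) → (f x ≤₂ y → x ≤₁ g y) × (x ≤₁ g y → f x ≤₂ y))

PreservesCompact : ∀ {a} (L M : CompleteLattice a) → (Carrier L → Carrier M) → Set (suc a)
PreservesCompact L M f = ∀ k → IsCompact L k → IsCompact M (f k)

restrictK : ∀ {a} (L M : CompleteLattice a) (f : Carrier L → Carrier M) →
  PreservesCompact L M f → K L → K M
restrictK L M f pf (k , kc) = f k , pf k kc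

-- The restricted maps are monotone maps between subposets, so g|K is a right
-- adjoint of f|K as soon as it is defined, i.e. as soon as g preserves
-- compactness. Conversely, if h is any right adjoint of f|K and m is compact,
-- then h m ≤ g m by the counit f (h m) ≤ m, while every compact c ≤ g m
-- satisfies f c ≤ m, hence c ≤ h m; as L is algebraic, g m ≤ h m. So g m ≈ h m
-- is compact.
module Submission where

open import Defs
open import Level using (Level)
open import Data.Product using (Σ-syntax; _×_; _,_; proj₁; proj₂)
open import Function.Bundles using (_⇔_; mk⇔)

module _ {a : Level} (L : CompleteLattice a) where
  open CompleteLattice L

  IsCompact-resp-≈ : ∀ {k k′} → k ≈ k′ → IsCompact k′ → IsCompact k
  IsCompact-resp-≈ k≈k′ k′-compact S k≤⋁S
    with k′-compact S (trans (reflexive (Eq.sym k≈k′)) k≤⋁S)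
  ... | F , F⊆S , k′≤⋁F = F , F⊆S , trans (reflexive k≈k′) k′≤⋁F

  ≤-fromCompactsBelow : IsAlgebraic → ∀ {x y} →
    (∀ c → IsCompact c → c ≤ x → c ≤ y) → x ≤ y
  ≤-fromCompactsBelow algebraic {x} below with algebraic x
  ... | S , S-compact , x≈⋁S =
    trans (reflexive x≈⋁S) (⋁-least S λ c∈S →
      below _ (S-compact c∈S) (trans (⋁-upper S c∈S) (reflexive (Eq.sym x≈⋁S))))

module _ {a : Level} (L M : CompleteLattice a)
  {f : CompleteLattice.Carrier L → CompleteLattice.Carrier M}
  {g : CompleteLattice.Carrier M → CompleteLattice.Carrier L}
  (f⊣g : IsAdjunction (CompleteLattice._≤_ L) (CompleteLattice._≤_ M) f g)
  (fK : PreservesCompact L M f) where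
  private
    module L = CompleteLattice L
    module M = CompleteLattice M

    f-mono : Monotone L._≤_ M._≤_ f
    f-mono = proj₁ f⊣g

    g-mono : Monotone M._≤_ L._≤_ g
    g-mono = proj₁ (proj₂ f⊣g)

    f⊣g-galois : ∀ x y → (f x M.≤ y → x L.≤ g y) × (x L.≤ g y → f x M.≤ y)
    f⊣g-galois = proj₂ (proj₂ f⊣g)

  restrictK-adjunction : (gK : PreservesCompact M L g) →
    IsAdjunction L._≤K_ M._≤K_ (restrictK L M f fK) (restrictK M L g gK)
  restrictK-adjunction gK =
    f-mono , g-mono , λ (x , _) (y , _) → f⊣g-galois x y

  rightAdjointK≈g : L.IsAlgebraic → (h : M.K → L.K) →
    IsAdjunction L._≤K_ M._≤K_ (restrictK L M f fK) h →
    (m : M.K) → proj₁ (h m) L.≈ g (proj₁ m)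
  rightAdjointK≈g algebraic h (_ , _ , h-galois) m@(m′ , _) =
    L.antisym hm≤gm gm≤hm
    where
      hm≤gm : proj₁ (h m) L.≤ g m′
      hm≤gm = proj₁ (f⊣g-galois _ m′) (proj₂ (h-galois (h m) m) L.refl)

      gm≤hm : g m′ L.≤ proj₁ (h m)
      gm≤hm = ≤-fromCompactsBelow L algebraic λ c c-compact c≤gm →
        proj₁ (h-galois (c , c-compact) m) (proj₂ (f⊣g-galois c m′) c≤gm)

  rightAdjointK⇒preservesCompact : L.IsAlgebraic →
    Σ[ h ∈ (M.K → L.K) ] IsAdjunction L._≤K_ M._≤K_ (restrictK L M f fK) h →
    PreservesCompact M L g
  rightAdjointK⇒preservesCompact algebraic (h , h-adj) m m-compact =
    IsCompact-resp-≈ L (L.Eq.sym (rightAdjointK≈g algebraic h h-adj (m , m-compact)))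
      (proj₂ (h (m , m-compact)))

proposition2p2 : {a : Level} (L M : CompleteLattice a) →
    CompleteLattice.IsAlgebraic L → CompleteLattice.IsAlgebraic M →
    (f : CompleteLattice.Carrier L → CompleteLattice.Carrier M) →
    (g : CompleteLattice.Carrier M → CompleteLattice.Carrier L) →
    IsAdjunction (CompleteLattice._≤_ L) (CompleteLattice._≤_ M) f g →
    (fK : PreservesCompact L M f) →
    ((Σ[ h ∈ (CompleteLattice.K M → CompleteLattice.K L) ]
        IsAdjunction (CompleteLattice._≤K_ L) (CompleteLattice._≤K_ M) (restrictK L M f fK) h)
      ⇔ PreservesCompact M L g)
    × ((gK : PreservesCompact M L g) →
        IsAdjunction (CompleteLattice._≤K_ L) (CompleteLattice._≤K_ M) (restrictK L M f fK) (restrictK M L g gK))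
    × ((h : CompleteLattice.K M → CompleteLattice.K L) →
        IsAdjunction (CompleteLattice._≤K_ L) (CompleteLattice._≤K_ M) (restrictK L M f fK) h →
        (m : CompleteLattice.K M) → CompleteLattice._≈_ L (proj₁ (h m)) (g (proj₁ m)))
proposition2p2 L M algebraicL _ f g f⊣g fK =
  mk⇔ (rightAdjointK⇒preservesCompact L M f⊣g fK algebraicL)
      (λ gK → restrictK M L g gK , restrictK-adjunction L M f⊣g fK gK)
  , restrictK-adjunction L M f⊣g fK
  , rightAdjointK≈g L M f⊣g fK algebraicL
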